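{- For all integers $n>1$, $c\ge1$ and $0\le k\le (c-1)n+c\binom{n}{2}$, we have $i_c(n,k)=i_c(n,k-1)+i_c(n-1,k)-i_c(n-1,k-cn)$.
   Context: For integers $n\ge1$, $c\ge1$, let $G_{c,n}$ be the set of colored permutations: words $\sigma=\sigma_1^{[c_1]}\cdots\sigma_n^{[c_n]}$ where $|\sigma|=\sigma_1\cdots\sigma_n$ is a permutation of $[n]$ and each color $c_i\in\{0,\dots,c-1\}$. For a permutation $\pi$ of $[n]$, $\mathrm{inv}(\pi)=|\{(i,j):i<j,\ \pi_i>\pi_j\}|$. Let $\mathrm{col}(\sigma)=c_1+\cdots+c_n$ and $\mathrm{inv}_c(\sigma)=\mathrm{inv}(|\sigma|)+\mathrm{col}(\sigma)+c\cdot|\{(i,j):1\le i<j\le n,\ \sigma_i<\sigma_j,\ c_j\ne0\}|$. Define $i_c(n,k)=|\{\sigma\in G_{c,n}:\mathrm{inv}_c(\sigma)=k\}|$ for all integers $k$ (so $i_c(n,k)=0$ for $k<0$). -}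

module Defs where

open import Data.Nat using (ℕ; zero; suc; _+_; _*_; _<ᵇ_; _≡ᵇ_)
open import Data.Bool using (Bool; true; false; _∧_; not; if_then_else_)
open import Data.Fin using (Fin; toℕ)
open import Data.Fin.Properties using (_≟_)
open import Data.List using (List; []; _∷_; [_]; map; concatMap; allFin; length; filterᵇ)
open import Data.Nat.ListAction using (sum)
open import Data.Vec using (Vec; lookup) renaming ([] to []ᵥ; _∷_ to _∷ᵥ_)
open import Data.Integer using (ℤ; +_)
import Data.Integer as ℤ
open import Data.Product using (_×_; _,_)
open import Relation.Nullary.Decidable using (⌊_⌋)

allWords : (m n : ℕ) → List (Vec (Fin m) n)
allWords m zero = [ []ᵥ ]
allWords m (suc n) = concatMap (λ x → map (x ∷ᵥ_) (allWords m n)) (allFin m)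

countPairs : {n : ℕ} → (Fin n → Fin n → Bool) → ℕ
countPairs {n} P =
  sum (map (λ i → length (filterᵇ (λ j → (toℕ i <ᵇ toℕ j) ∧ P i j) (allFin n))) (allFin n))

isPerm : {n : ℕ} → Vec (Fin n) n → Bool
isPerm {n} w = countPairs (λ i j → ⌊ lookup w i ≟ lookup w j ⌋) ≡ᵇ 0

-- permutations of [n] (0-indexed: letters Fin n stand for 1..n), in one-line notation
perms : (n : ℕ) → List (Vec (Fin n) n)
perms n = filterᵇ isPerm (allWords n n)

-- colored permutations G_{c,n}: pairs (|σ| , colour vector with colours in {0..c-1})
G : (c n : ℕ) → List (Vec (Fin n) n × Vec (Fin c) n)
G c n = concatMap (λ p → map (λ col → p , col) (allWords c n)) (perms n)

inv : {n : ℕ} → Vec (Fin n) n → ℕ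
inv w = countPairs (λ i j → toℕ (lookup w j) <ᵇ toℕ (lookup w i))

col : {c n : ℕ} → Vec (Fin c) n → ℕ
col []ᵥ = 0
col (x ∷ᵥ xs) = toℕ x + col xs

invc : (c : ℕ) {n : ℕ} → Vec (Fin n) n × Vec (Fin c) n → ℕ
invc c (w , cs) =
  inv w + col cs
    + c * countPairs (λ i j → (toℕ (lookup w i) <ᵇ toℕ (lookup w j)) ∧ not (toℕ (lookup cs j) ≡ᵇ 0))

-- i_c(n,k) for integer k (it is 0 for k < 0)
icount : (c n : ℕ) → ℤ → ℕ
icount c n (+ k) = length (filterᵇ (λ σ → invc c σ ≡ᵇ k) (G c n))
icount c n ℤ.-[1+ _ ] = 0

{-# OPTIONS --safe #-}
-- Deleting the last letter v (of colour d) of a coloured permutation of {0, …, L} and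
-- standardising the remaining letters (punchOut v) is a bijection
-- G_{c,L+1} ≅ {0..L} × {0..c-1} × G_{c,L}. Under it inv_c grows by
-- (L - v) + d + c·v·[d ≠ 0], and as (v , d) ranges over all pairs this increment takes
-- each value 0, 1, …, c(L+1) - 1 exactly once. Hence i_c(n,k) = Σ_{j<cn} i_c(n-1,k-j)
-- for every integer k, and the recurrence is the difference of two consecutive such
-- window sums.
module Submission where

open import Defs
open import Data.Nat using (ℕ; _≤_; _<_; _*_; _∸_; _+_)
open import Data.Nat.Combinatorics using (_C_)
open import Data.Integer using (ℤ; +_; _-_) renaming (_+_ to _+ℤ_; _*_ to _*ℤ_)
open import Relation.Binary.PropositionalEquality using (_≡_)

open import Algebra.Bundles using (AbelianGroup; CommutativeMonoid)
open import Data.Bool using (Bool; true; false; if_then_else_; _∧_; not)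
open import Data.Bool.Properties
  using (∧-assoc; ∧-comm; ∧-identityʳ; ∧-zeroʳ; ∧-conicalˡ; ∧-conicalʳ; ∧-commutativeMonoid)
open import Data.Fin using (Fin; zero; suc; toℕ; fromℕ; inject₁; punchIn; punchOut)
open import Data.Fin.Properties
  using (_≟_; toℕ-inject₁; toℕ-fromℕ; toℕ≤pred[n]; punchIn-injective; punchIn-punchOut; punchInᵢ≢i)
open import Data.Integer using (-[1+_])
import Data.Integer.Properties as ℤ
open import Data.List using (List; []; _∷_; _++_; concatMap; allFin; tabulate; filterᵇ; length)
import Data.List as List
open import Data.List.Properties using (map-++; map-cong; map-∘)
open import Data.Nat using (zero; suc; _<ᵇ_; _≡ᵇ_)
import Data.Nat.ListAction as ListAction
open import Data.Nat.ListAction.Properties using (sum-++)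
open import Data.Nat.Properties
  using (+-0-commutativeMonoid; +-commutativeSemigroup; +-assoc; +-comm; +-identityʳ; *-zeroʳ; *-comm; m∸n+n≡m)
open import Data.Nat.Tactic.RingSolver using (solve-∀)
open import Data.Product using (∃-syntax; _,_; _×_)
open import Data.Vec using (Vec; []; _∷_; _∷ʳ_; lookup; map)
open import Data.Vec.Properties using (lookup-map)
open import Function.Base using (_∘_)
open import Function.Bundles using (mk⇔)
open import Relation.Nullary.Decidable using (does; does-⇔; yes; no; isYes; dec-true; dec-false)
open import Relation.Binary.PropositionalEquality using (refl; sym; trans; cong; cong₂; module ≡-Reasoning)
open import Algebra.Properties.CommutativeMonoid.Sum +-0-commutativeMonoid
  using (sum; sum-syntax; sum-cong-≗; ∑-distrib-+; sum-replicate-zero; sum-init-last; sum-remove)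
open import Algebra.Properties.CommutativeSemigroup +-commutativeSemigroup
  using () renaming (interchange to +-interchange)
open import Algebra.Properties.CommutativeSemigroup
  (CommutativeMonoid.commutativeSemigroup ∧-commutativeMonoid) using () renaming (interchange to ∧-interchange)
open import Algebra.Properties.Group (AbelianGroup.group ℤ.+-0-abelianGroup)
  using (//-rightDividesˡ; //-rightDividesʳ)
open ≡-Reasoning

private variable
  A B : Set
  c m n L : ℕ

𝟙 : Bool → ℕ
𝟙 b = if b then 1 else 0

if-∧ : ∀ a b (x : ℕ) → (if a ∧ b then x else 0) ≡ (if a then (if b then x else 0) else 0)
if-∧ true b x = refl
if-∧ false b x = refl

∑ˡ : List A → (A → ℕ) → ℕ
∑ˡ xs f = ListAction.sum (List.map f xs)

infixl 10 ∑ˡ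
syntax ∑ˡ xs (λ x → e) = ∑[ x ∈ xs ] e

∑ˡ-cong : ∀ (xs : List A) {f g : A → ℕ} → (∀ x → f x ≡ g x) → ∑ˡ xs f ≡ ∑ˡ xs g
∑ˡ-cong xs f≗g = cong ListAction.sum (map-cong f≗g xs)

∑ˡ-++ : ∀ (xs ys : List A) (f : A → ℕ) → ∑ˡ (xs ++ ys) f ≡ ∑ˡ xs f + ∑ˡ ys f
∑ˡ-++ xs ys f = trans (cong ListAction.sum (map-++ f xs ys)) (sum-++ (List.map f xs) (List.map f ys))

∑ˡ-map : ∀ (g : A → B) (xs : List A) (f : B → ℕ) → ∑ˡ (List.map g xs) f ≡ ∑[ x ∈ xs ] f (g x)
∑ˡ-map g xs f = cong ListAction.sum (sym (map-∘ xs))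

∑ˡ-concatMap : ∀ (g : A → List B) (xs : List A) (f : B → ℕ) →
  ∑ˡ (concatMap g xs) f ≡ ∑[ x ∈ xs ] ∑ˡ (g x) f
∑ˡ-concatMap g [] f = refl
∑ˡ-concatMap g (x ∷ xs) f = trans (∑ˡ-++ (g x) _ f) (cong (_+_ (∑ˡ (g x) f)) (∑ˡ-concatMap g xs f))

∑ˡ-tabulate : ∀ (g : Fin n → A) (f : A → ℕ) → ∑ˡ (tabulate g) f ≡ ∑[ i < n ] f (g i)
∑ˡ-tabulate {zero} g f = refl
∑ˡ-tabulate {suc n} g f = cong (_+_ (f (g zero))) (∑ˡ-tabulate (g ∘ suc) f)

∑ˡ-allFin : ∀ n (f : Fin n → ℕ) → ∑ˡ (allFin n) f ≡ ∑[ i < n ] f i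
∑ˡ-allFin n = ∑ˡ-tabulate (λ i → i)

∑ˡ-zero : ∀ (xs : List A) → ∑[ x ∈ xs ] 0 ≡ 0
∑ˡ-zero [] = refl
∑ˡ-zero (x ∷ xs) = ∑ˡ-zero xs

∑ˡ-if : ∀ b (xs : List A) (f : A → ℕ) → ∑[ x ∈ xs ] (if b then f x else 0) ≡ (if b then ∑ˡ xs f else 0)
∑ˡ-if true xs f = refl
∑ˡ-if false xs f = ∑ˡ-zero xs

∑ˡ-∑-comm : ∀ (xs : List A) (f : A → Fin n → ℕ) →
  ∑[ x ∈ xs ] ∑[ i < n ] f x i ≡ ∑[ i < n ] ∑[ x ∈ xs ] f x i
∑ˡ-∑-comm {n = n} [] f = sym (sum-replicate-zero n)
∑ˡ-∑-comm (x ∷ xs) f = trans (cong (_+_ (sum (f x))) (∑ˡ-∑-comm xs f)) (sym (∑-distrib-+ (f x) _))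

∑ˡ-filterᵇ : ∀ (p : A → Bool) (xs : List A) (f : A → ℕ) →
  ∑ˡ (filterᵇ p xs) f ≡ ∑[ x ∈ xs ] (if p x then f x else 0)
∑ˡ-filterᵇ p [] f = refl
∑ˡ-filterᵇ p (x ∷ xs) f with p x
... | true = cong (_+_ (f x)) (∑ˡ-filterᵇ p xs f)
... | false = ∑ˡ-filterᵇ p xs f

∑ˡ-filterᵇ-cong : ∀ (p : A → Bool) (xs : List A) {f g : A → ℕ} → (∀ x → p x ≡ true → f x ≡ g x) →
  ∑ˡ (filterᵇ p xs) f ≡ ∑ˡ (filterᵇ p xs) g
∑ˡ-filterᵇ-cong p [] f≗g = refl
∑ˡ-filterᵇ-cong p (x ∷ xs) f≗g with p x in px
... | true = cong₂ _+_ (f≗g x px) (∑ˡ-filterᵇ-cong p xs f≗g)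
... | false = ∑ˡ-filterᵇ-cong p xs f≗g

length-filterᵇ : ∀ (p : A → Bool) (xs : List A) → length (filterᵇ p xs) ≡ ∑[ x ∈ xs ] 𝟙 (p x)
length-filterᵇ p [] = refl
length-filterᵇ p (x ∷ xs) with p x
... | true = cong suc (length-filterᵇ p xs)
... | false = length-filterᵇ p xs

∑-toℕ-last : ∀ n (h : ℕ → ℕ) → ∑[ j < suc n ] h (toℕ j) ≡ ∑[ j < n ] h (toℕ j) + h n
∑-toℕ-last n h = trans (sum-init-last {n} (h ∘ toℕ))
  (cong₂ _+_ (sum-cong-≗ {n} (λ j → cong h (toℕ-inject₁ j))) (cong h (toℕ-fromℕ n)))

∑-toℕ-+ : ∀ m n (h : ℕ → ℕ) → ∑[ j < m + n ] h (toℕ j) ≡ ∑[ j < m ] h (toℕ j) + ∑[ j < n ] h (m + toℕ j)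
∑-toℕ-+ zero n h = refl
∑-toℕ-+ (suc m) n h = trans (cong (_+_ (h 0)) (∑-toℕ-+ m n (h ∘ suc))) (sym (+-assoc (h 0) _ _))

∑-toℕ-* : ∀ m n (h : ℕ → ℕ) → ∑[ i < m ] ∑[ j < n ] h (toℕ i * n + toℕ j) ≡ ∑[ j < m * n ] h (toℕ j)
∑-toℕ-* zero n h = refl
∑-toℕ-* (suc m) n h = begin
  ∑[ j < n ] h (toℕ j) + ∑[ i < m ] ∑[ j < n ] h (n + toℕ i * n + toℕ j)
    ≡⟨ cong (_+_ (∑[ j < n ] h (toℕ j))) (sum-cong-≗ {m} λ i → sum-cong-≗ {n} λ j → cong h (+-assoc n _ _)) ⟩
  ∑[ j < n ] h (toℕ j) + ∑[ i < m ] ∑[ j < n ] h (n + (toℕ i * n + toℕ j))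
    ≡⟨ cong (_+_ (∑[ j < n ] h (toℕ j))) (∑-toℕ-* m n (λ x → h (n + x))) ⟩
  ∑[ j < n ] h (toℕ j) + ∑[ j < m * n ] h (n + toℕ j)
    ≡⟨ ∑-toℕ-+ n (m * n) h ⟨
  ∑[ j < n + m * n ] h (toℕ j) ∎

∑-toℕ-reverse : ∀ n (h : ℕ → ℕ) → ∑[ j < suc n ] h (n ∸ toℕ j) ≡ ∑[ j < suc n ] h (toℕ j)
∑-toℕ-reverse zero h = refl
∑-toℕ-reverse (suc n) h = begin
  h (suc n) + ∑[ j < suc n ] h (n ∸ toℕ j) ≡⟨ cong (_+_ (h (suc n))) (∑-toℕ-reverse n h) ⟩
  h (suc n) + ∑[ j < suc n ] h (toℕ j)     ≡⟨ +-comm (h (suc n)) _ ⟩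
  ∑[ j < suc n ] h (toℕ j) + h (suc n)     ≡⟨ ∑-toℕ-last (suc n) h ⟨
  ∑[ j < suc (suc n) ] h (toℕ j)           ∎

∑-window-shift : ∀ (b : ℤ → ℕ) N k →
  ∑[ j < N ] b (k - + toℕ j) + b (k - + N) ≡ b k + ∑[ j < N ] b (k - + 1 - + toℕ j)
∑-window-shift b N k = begin
  ∑[ j < N ] b (k - + toℕ j) + b (k - + N) ≡⟨ ∑-toℕ-last N (λ x → b (k - + x)) ⟨
  ∑[ j < suc N ] b (k - + toℕ j)           ≡⟨ cong₂ _+_ (cong b (ℤ.+-identityʳ k))
                                                (sum-cong-≗ {N} λ j → cong b (k-[1+i]≡k-1-i (+ toℕ j))) ⟩
  b k + ∑[ j < N ] b (k - + 1 - + toℕ j)   ∎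
  where
  k-[1+i]≡k-1-i : ∀ i → k - (+ 1 +ℤ i) ≡ k - + 1 - i
  k-[1+i]≡k-1-i i = trans (cong (k +ℤ_) (ℤ.neg-distrib-+ (+ 1) i)) (sym (ℤ.+-assoc k _ _))

window-recurrence : (a b : ℤ → ℕ) (N : ℕ) → (∀ k → a k ≡ ∑[ j < N ] b (k - + toℕ j)) →
  ∀ k → + a k ≡ (+ a (k - + 1) +ℤ + b k) - + b (k - + N)
window-recurrence a b N a≡∑b k = begin
  + a k                                 ≡⟨ //-rightDividesʳ (+ b (k - + N)) (+ a k) ⟨
  + (a k + b (k - + N)) - + b (k - + N) ≡⟨ cong (λ x → + x - + b (k - + N)) shifted ⟩
  + (a (k - + 1) + b k) - + b (k - + N) ∎
  where
  shifted : a k + b (k - + N) ≡ a (k - + 1) + b k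
  shifted = begin
    a k + b (k - + N)                        ≡⟨ cong (λ s → s + b (k - + N)) (a≡∑b k) ⟩
    ∑[ j < N ] b (k - + toℕ j) + b (k - + N) ≡⟨ ∑-window-shift b N k ⟩
    b k + ∑[ j < N ] b (k - + 1 - + toℕ j)   ≡⟨ cong (_+_ (b k)) (a≡∑b (k - + 1)) ⟨
    b k + a (k - + 1)                        ≡⟨ +-comm (b k) _ ⟩
    a (k - + 1) + b k                        ∎

countPairs-∑ : (P : Fin n → Fin n → Bool) →
  countPairs P ≡ ∑[ i < n ] ∑[ j < n ] 𝟙 ((toℕ i <ᵇ toℕ j) ∧ P i j)
countPairs-∑ {n} P =
  trans (∑ˡ-allFin n _) (sum-cong-≗ {n} λ i → trans (length-filterᵇ _ (allFin n)) (∑ˡ-allFin n _))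

countPairs-cong : {P Q : Fin n → Fin n → Bool} → (∀ i j → P i j ≡ Q i j) → countPairs P ≡ countPairs Q
countPairs-cong {n} {P} {Q} P≗Q = begin
  countPairs P                                        ≡⟨ countPairs-∑ P ⟩
  ∑[ i < n ] ∑[ j < n ] 𝟙 ((toℕ i <ᵇ toℕ j) ∧ P i j) ≡⟨ sum-cong-≗ {n} (λ i → sum-cong-≗ {n} λ j →
                                                           cong (λ b → 𝟙 ((toℕ i <ᵇ toℕ j) ∧ b)) (P≗Q i j)) ⟩
  ∑[ i < n ] ∑[ j < n ] 𝟙 ((toℕ i <ᵇ toℕ j) ∧ Q i j) ≡⟨ countPairs-∑ Q ⟨
  countPairs Q                                        ∎

countPairs-suc : (P : Fin (suc n) → Fin (suc n) → Bool) →
  countPairs P ≡ ∑[ j < n ] 𝟙 (P zero (suc j)) + countPairs (λ i j → P (suc i) (suc j))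
countPairs-suc {n} P = trans (countPairs-∑ P)
  (cong (_+_ (∑[ j < n ] 𝟙 (P zero (suc j)))) (sym (countPairs-∑ (λ i j → P (suc i) (suc j)))))

countPairs-last : (P : Fin (suc n) → Fin (suc n) → Bool) →
  countPairs P ≡ countPairs (λ i j → P (inject₁ i) (inject₁ j)) + ∑[ i < n ] 𝟙 (P (inject₁ i) (fromℕ n))
countPairs-last {zero} P = countPairs-suc P
countPairs-last {suc n} P = begin
  countPairs P
    ≡⟨ countPairs-suc P ⟩
  ∑[ j < suc n ] 𝟙 (P zero (suc j)) + countPairs (λ i j → P (suc i) (suc j))
    ≡⟨ cong₂ _+_ (sum-init-last {n} (λ j → 𝟙 (P zero (suc j)))) (countPairs-last (λ i j → P (suc i) (suc j))) ⟩
  (first-inner + first-last) + (inner + inner-last)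
    ≡⟨ +-interchange first-inner first-last inner inner-last ⟩
  (first-inner + inner) + (first-last + inner-last)
    ≡⟨ cong (λ s → s + (first-last + inner-last)) (countPairs-suc (λ i j → P (inject₁ i) (inject₁ j))) ⟨
  countPairs (λ i j → P (inject₁ i) (inject₁ j)) + ∑[ i < suc n ] 𝟙 (P (inject₁ i) (fromℕ (suc n))) ∎
  where
  first-inner first-last inner inner-last : ℕ
  first-inner = ∑[ j < n ] 𝟙 (P zero (suc (inject₁ j)))
  first-last = 𝟙 (P zero (suc (fromℕ n)))
  inner = countPairs (λ i j → P (suc (inject₁ i)) (suc (inject₁ j)))
  inner-last = ∑[ i < n ] 𝟙 (P (suc (inject₁ i)) (suc (fromℕ n)))

lookup-∷ʳ-inject₁ : ∀ (w : Vec A L) x i → lookup (w ∷ʳ x) (inject₁ i) ≡ lookup w i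
lookup-∷ʳ-inject₁ (y ∷ w) x zero = refl
lookup-∷ʳ-inject₁ (y ∷ w) x (suc i) = lookup-∷ʳ-inject₁ w x i

lookup-∷ʳ-last : ∀ (w : Vec A L) x → lookup (w ∷ʳ x) (fromℕ L) ≡ x
lookup-∷ʳ-last [] x = refl
lookup-∷ʳ-last (y ∷ w) x = lookup-∷ʳ-last w x

pairCount : (A → B → A → B → Bool) → Vec A L → Vec B L → ℕ
pairCount Q w cs = countPairs (λ i j → Q (lookup w i) (lookup cs i) (lookup w j) (lookup cs j))

pairCount-∷ʳ : ∀ (Q : A → B → A → B → Bool) (w : Vec A L) (cs : Vec B L) x e →
  pairCount Q (w ∷ʳ x) (cs ∷ʳ e) ≡ pairCount Q w cs + ∑[ i < L ] 𝟙 (Q (lookup w i) (lookup cs i) x e)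
pairCount-∷ʳ {A = A} {B = B} {L = L} Q w cs x e = trans (countPairs-last {L} P) (cong₂ _+_
  (countPairs-cong λ i j → cong₂ Q′ (before i) (before j))
  (sum-cong-≗ {L} λ i → cong 𝟙 (cong₂ Q′ (before i) (cong₂ _,_ (lookup-∷ʳ-last w x) (lookup-∷ʳ-last cs e)))))
  where
  Q′ : A × B → A × B → Bool
  Q′ (a , b) (a′ , b′) = Q a b a′ b′
  P : Fin (suc L) → Fin (suc L) → Bool
  P i j = Q (lookup (w ∷ʳ x) i) (lookup (cs ∷ʳ e) i) (lookup (w ∷ʳ x) j) (lookup (cs ∷ʳ e) j)
  before : ∀ i → (lookup (w ∷ʳ x) (inject₁ i) , lookup (cs ∷ʳ e) (inject₁ i)) ≡ (lookup w i , lookup cs i)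
  before i = cong₂ _,_ (lookup-∷ʳ-inject₁ w x i) (lookup-∷ʳ-inject₁ cs e i)

pairCount-map : ∀ {A′ : Set} (Q : A → B → A → B → Bool) (R : A′ → B → A′ → B → Bool) (f : A′ → A) →
  (∀ a b a′ b′ → Q (f a) b (f a′) b′ ≡ R a b a′ b′) →
  (w : Vec A′ L) (cs : Vec B L) → pairCount Q (map f w) cs ≡ pairCount R w cs
pairCount-map Q R f Q∘f≡R w cs = countPairs-cong λ i j →
  trans (cong₂ (λ a a′ → Q a (lookup cs i) a′ (lookup cs j)) (lookup-map i f w) (lookup-map j f w)) (Q∘f≡R _ _ _ _)

-- The statistic on coloured words over an arbitrary alphabet

inversion : Fin m → Fin c → Fin m → Fin c → Bool
inversion a _ a′ _ = toℕ a′ <ᵇ toℕ a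

colouredAscent : Fin m → Fin c → Fin m → Fin c → Bool
colouredAscent a _ a′ d′ = (toℕ a <ᵇ toℕ a′) ∧ not (toℕ d′ ≡ᵇ 0)

-- invc c (w , cs) unfolds to invcʷ c w cs.
invcʷ : (c : ℕ) → Vec (Fin m) L → Vec (Fin c) L → ℕ
invcʷ c w cs = pairCount inversion w cs + col cs + c * pairCount colouredAscent w cs

appendInv : (c : ℕ) → Vec (Fin m) L → Vec (Fin c) L → Fin m → Fin c → ℕ
appendInv {L = L} c w cs v d =
  ∑[ i < L ] 𝟙 (inversion (lookup w i) (lookup cs i) v d) + toℕ d
    + c * ∑[ i < L ] 𝟙 (colouredAscent (lookup w i) (lookup cs i) v d)

col-∷ʳ : ∀ (cs : Vec (Fin c) L) d → col (cs ∷ʳ d) ≡ col cs + toℕ d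
col-∷ʳ [] d = +-comm (toℕ d) 0
col-∷ʳ (e ∷ cs) d = trans (cong (_+_ (toℕ e)) (col-∷ʳ cs d)) (sym (+-assoc (toℕ e) _ _))

invcʷ-∷ʳ : ∀ c (w : Vec (Fin m) L) cs v d → invcʷ c (w ∷ʳ v) (cs ∷ʳ d) ≡ invcʷ c w cs + appendInv c w cs v d
invcʷ-∷ʳ {L = L} c w cs v d = begin
  pairCount inversion (w ∷ʳ v) (cs ∷ʳ d) + col (cs ∷ʳ d) + c * pairCount colouredAscent (w ∷ʳ v) (cs ∷ʳ d)
    ≡⟨ cong₂ (λ p q → p + col (cs ∷ʳ d) + c * q)
             (pairCount-∷ʳ inversion w cs v d) (pairCount-∷ʳ colouredAscent w cs v d) ⟩
  (invs + newInvs) + col (cs ∷ʳ d) + c * (ascs + newAscs)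
    ≡⟨ cong (λ s → (invs + newInvs) + s + c * (ascs + newAscs)) (col-∷ʳ cs d) ⟩
  (invs + newInvs) + (col cs + toℕ d) + c * (ascs + newAscs)
    ≡⟨ regroup c invs newInvs (col cs) (toℕ d) ascs newAscs ⟩
  invcʷ c w cs + appendInv c w cs v d ∎
  where
  invs newInvs ascs newAscs : ℕ
  invs = pairCount inversion w cs
  newInvs = ∑[ i < L ] 𝟙 (inversion (lookup w i) (lookup cs i) v d)
  ascs = pairCount colouredAscent w cs
  newAscs = ∑[ i < L ] 𝟙 (colouredAscent (lookup w i) (lookup cs i) v d)
  regroup : ∀ c p i q e r a → (p + i) + (q + e) + c * (r + a) ≡ (p + q + c * r) + (i + e + c * a)
  regroup = solve-∀

punchIn-<ᵇ : ∀ (v : Fin (suc m)) a b → (toℕ (punchIn v a) <ᵇ toℕ (punchIn v b)) ≡ (toℕ a <ᵇ toℕ b)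
punchIn-<ᵇ zero a b = refl
punchIn-<ᵇ (suc v) zero zero = refl
punchIn-<ᵇ (suc v) zero (suc b) = refl
punchIn-<ᵇ (suc v) (suc a) zero = refl
punchIn-<ᵇ (suc v) (suc a) (suc b) = punchIn-<ᵇ v a b

invcʷ-punchIn : ∀ c (v : Fin (suc m)) (w : Vec (Fin m) L) cs → invcʷ c (map (punchIn v) w) cs ≡ invcʷ c w cs
invcʷ-punchIn c v w cs = cong₂ (λ p q → p + col cs + c * q)
  (pairCount-map inversion inversion (punchIn v) (λ a _ a′ _ → punchIn-<ᵇ v a′ a) w cs)
  (pairCount-map colouredAscent colouredAscent (punchIn v)
    (λ a _ a′ d′ → cong (λ b → b ∧ not (toℕ d′ ≡ᵇ 0)) (punchIn-<ᵇ v a a′)) w cs)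

-- Words with distinct letters

notIn : Fin m → Vec (Fin m) L → Bool
notIn x [] = true
notIn x (y ∷ w) = not (does (x ≟ y)) ∧ notIn x w

distinct : Vec (Fin m) L → Bool
distinct [] = true
distinct (x ∷ w) = notIn x w ∧ distinct w

≡ᵇ0-+ : ∀ a b → (a + b ≡ᵇ 0) ≡ (a ≡ᵇ 0) ∧ (b ≡ᵇ 0)
≡ᵇ0-+ zero b = refl
≡ᵇ0-+ (suc a) b = refl

notIn-∑ : ∀ (x : Fin m) (w : Vec (Fin m) L) → (∑[ j < L ] 𝟙 (isYes (x ≟ lookup w j)) ≡ᵇ 0) ≡ notIn x w
notIn-∑ x [] = refl
notIn-∑ x (y ∷ w) with x ≟ y
... | yes _ = refl
... | no _ = notIn-∑ x w

-- For m = L the left-hand side is isPerm w.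
isPerm≡distinct : ∀ (w : Vec (Fin m) L) → (countPairs (λ i j → isYes (lookup w i ≟ lookup w j)) ≡ᵇ 0) ≡ distinct w
isPerm≡distinct [] = refl
isPerm≡distinct {L = suc L} (x ∷ w) = begin
  (countPairs (λ i j → isYes (lookup (x ∷ w) i ≟ lookup (x ∷ w) j)) ≡ᵇ 0)
    ≡⟨ cong (_≡ᵇ 0) (countPairs-suc {L} (λ i j → isYes (lookup (x ∷ w) i ≟ lookup (x ∷ w) j))) ⟩
  (repeatsOfx + repeatsInw ≡ᵇ 0)
    ≡⟨ ≡ᵇ0-+ repeatsOfx repeatsInw ⟩
  (repeatsOfx ≡ᵇ 0) ∧ (repeatsInw ≡ᵇ 0)
    ≡⟨ cong₂ _∧_ (notIn-∑ x w) (isPerm≡distinct w) ⟩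
  notIn x w ∧ distinct w ∎
  where
  repeatsOfx repeatsInw : ℕ
  repeatsOfx = ∑[ j < L ] 𝟙 (isYes (x ≟ lookup w j))
  repeatsInw = countPairs (λ i j → isYes (lookup w i ≟ lookup w j))

≟-sym : ∀ (x y : Fin m) → does (x ≟ y) ≡ does (y ≟ x)
≟-sym x y = does-⇔ (mk⇔ sym sym) (x ≟ y) (y ≟ x)

notIn-∷ʳ : ∀ (x : Fin m) (w : Vec (Fin m) L) y → notIn x (w ∷ʳ y) ≡ notIn x w ∧ not (does (x ≟ y))
notIn-∷ʳ x [] y = ∧-identityʳ _
notIn-∷ʳ x (z ∷ w) y =
  trans (cong (_∧_ (not (does (x ≟ z)))) (notIn-∷ʳ x w y)) (sym (∧-assoc (not (does (x ≟ z))) (notIn x w) _))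

distinct-∷ʳ : ∀ (w : Vec (Fin m) L) v → distinct (w ∷ʳ v) ≡ notIn v w ∧ distinct w
distinct-∷ʳ [] v = refl
distinct-∷ʳ (x ∷ w) v = begin
  notIn x (w ∷ʳ v) ∧ distinct (w ∷ʳ v)
    ≡⟨ cong₂ _∧_ (notIn-∷ʳ x w v) (distinct-∷ʳ w v) ⟩
  (notIn x w ∧ not (does (x ≟ v))) ∧ (notIn v w ∧ distinct w)
    ≡⟨ cong (λ b → (notIn x w ∧ not b) ∧ (notIn v w ∧ distinct w)) (≟-sym x v) ⟩
  (notIn x w ∧ not (does (v ≟ x))) ∧ (notIn v w ∧ distinct w)
    ≡⟨ cong (_∧ (notIn v w ∧ distinct w)) (∧-comm (notIn x w) _) ⟩
  (not (does (v ≟ x)) ∧ notIn x w) ∧ (notIn v w ∧ distinct w)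
    ≡⟨ ∧-interchange (not (does (v ≟ x))) (notIn x w) (notIn v w) (distinct w) ⟩
  (not (does (v ≟ x)) ∧ notIn v w) ∧ (notIn x w ∧ distinct w) ∎

≟-punchIn : ∀ (v : Fin (suc m)) a b → does (punchIn v a ≟ punchIn v b) ≡ does (a ≟ b)
≟-punchIn v a b = does-⇔ (mk⇔ (punchIn-injective v a b) (cong (punchIn v))) (punchIn v a ≟ punchIn v b) (a ≟ b)

notIn-punchIn : ∀ (v : Fin (suc m)) x (w : Vec (Fin m) L) → notIn (punchIn v x) (map (punchIn v) w) ≡ notIn x w
notIn-punchIn v x [] = refl
notIn-punchIn v x (y ∷ w) = cong₂ (λ b b′ → not b ∧ b′) (≟-punchIn v x y) (notIn-punchIn v x w)

distinct-punchIn : ∀ (v : Fin (suc m)) (w : Vec (Fin m) L) → distinct (map (punchIn v) w) ≡ distinct w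
distinct-punchIn v [] = refl
distinct-punchIn v (x ∷ w) = cong₂ _∧_ (notIn-punchIn v x w) (distinct-punchIn v w)

notIn⇒punchIn-image : ∀ (x : Fin (suc m)) (w : Vec (Fin (suc m)) L) → notIn x w ≡ true →
  ∃[ w′ ] map (punchIn x) w′ ≡ w
notIn⇒punchIn-image x [] _ = [] , refl
notIn⇒punchIn-image x (y ∷ w) x∉w with x ≟ y
notIn⇒punchIn-image x (y ∷ w) () | yes _
... | no x≢y = let w′ , w′↦w = notIn⇒punchIn-image x w x∉w in
               punchOut x≢y ∷ w′ , cong₂ _∷_ (punchIn-punchOut x≢y) w′↦w

∑-lookup-distinct : ∀ (w : Vec (Fin L) L) → distinct w ≡ true → (f : Fin L → ℕ) →
  ∑[ i < L ] f (lookup w i) ≡ ∑[ y < L ] f y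
∑-lookup-distinct [] _ f = refl
∑-lookup-distinct {suc L} (x ∷ w) x∷w-distinct f
  with w′ , refl ← notIn⇒punchIn-image x w (∧-conicalˡ _ _ x∷w-distinct) = begin
  f x + ∑[ i < L ] f (lookup (map (punchIn x) w′) i)
    ≡⟨ cong (_+_ (f x)) (sum-cong-≗ {L} λ i → cong f (lookup-map i (punchIn x) w′)) ⟩
  f x + ∑[ i < L ] f (punchIn x (lookup w′ i))
    ≡⟨ cong (_+_ (f x)) (∑-lookup-distinct w′ w′-distinct (f ∘ punchIn x)) ⟩
  f x + ∑[ y < L ] f (punchIn x y)
    ≡⟨ sum-remove {L} {x} f ⟨
  ∑[ y < suc L ] f y ∎
  where
  w′-distinct : distinct w′ ≡ true
  w′-distinct = trans (sym (distinct-punchIn x w′)) (∧-conicalʳ _ _ x∷w-distinct)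

-- The contribution of the last letter

∑-punchIn-above : ∀ (v : Fin (suc L)) → ∑[ y < L ] 𝟙 (toℕ v <ᵇ toℕ (punchIn v y)) ≡ L ∸ toℕ v
∑-punchIn-above {zero} zero = refl
∑-punchIn-above {suc L} zero = cong suc (∑-punchIn-above {L} zero)
∑-punchIn-above {suc L} (suc v) = ∑-punchIn-above v

∑-punchIn-below : ∀ (v : Fin (suc L)) → ∑[ y < L ] 𝟙 (toℕ (punchIn v y) <ᵇ toℕ v) ≡ toℕ v
∑-punchIn-below {L} zero = sum-replicate-zero L
∑-punchIn-below {suc L} (suc v) = cong suc (∑-punchIn-below v)

∑-lookup-punchIn : ∀ (v : Fin (suc L)) (w : Vec (Fin L) L) → distinct w ≡ true → (f : Fin (suc L) → ℕ) →
  ∑[ i < L ] f (lookup (map (punchIn v) w) i) ≡ ∑[ y < L ] f (punchIn v y)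
∑-lookup-punchIn {L} v w w-distinct f =
  trans (sum-cong-≗ {L} λ i → cong f (lookup-map i (punchIn v) w)) (∑-lookup-distinct w w-distinct (f ∘ punchIn v))

letters-above-punchIn : ∀ (v : Fin (suc L)) (w : Vec (Fin L) L) → distinct w ≡ true →
  ∑[ i < L ] 𝟙 (toℕ v <ᵇ toℕ (lookup (map (punchIn v) w) i)) ≡ L ∸ toℕ v
letters-above-punchIn v w w-distinct =
  trans (∑-lookup-punchIn v w w-distinct (λ a → 𝟙 (toℕ v <ᵇ toℕ a))) (∑-punchIn-above v)

letters-below-punchIn : ∀ (v : Fin (suc L)) (w : Vec (Fin L) L) → distinct w ≡ true → ∀ b →
  ∑[ i < L ] 𝟙 ((toℕ (lookup (map (punchIn v) w) i) <ᵇ toℕ v) ∧ b) ≡ (if b then toℕ v else 0)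
letters-below-punchIn {L} v w w-distinct true = begin
  ∑[ i < L ] 𝟙 ((toℕ (lookup (map (punchIn v) w) i) <ᵇ toℕ v) ∧ true)
    ≡⟨ ∑-lookup-punchIn v w w-distinct (λ a → 𝟙 ((toℕ a <ᵇ toℕ v) ∧ true)) ⟩
  ∑[ y < L ] 𝟙 ((toℕ (punchIn v y) <ᵇ toℕ v) ∧ true)
    ≡⟨ sum-cong-≗ {L} (λ y → cong 𝟙 (∧-identityʳ _)) ⟩
  ∑[ y < L ] 𝟙 (toℕ (punchIn v y) <ᵇ toℕ v)
    ≡⟨ ∑-punchIn-below v ⟩
  toℕ v ∎
letters-below-punchIn {L} v w _ false =
  trans (sum-cong-≗ {L} λ i → cong 𝟙 (∧-zeroʳ _)) (sum-replicate-zero L)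

lastInv : (c L : ℕ) → Fin (suc L) → Fin c → ℕ
lastInv c L v zero = L ∸ toℕ v
lastInv c L v (suc d) = L ∸ toℕ v + suc (toℕ d) + c * toℕ v

appendInv-punchIn : ∀ c (v : Fin (suc L)) (w : Vec (Fin L) L) cs d → distinct w ≡ true →
  appendInv c (map (punchIn v) w) cs v d ≡ lastInv c L v d
appendInv-punchIn {L} c v w cs zero w-distinct =
  trans (cong₂ (λ a b → a + 0 + c * b) (letters-above-punchIn v w w-distinct) (letters-below-punchIn v w w-distinct false))
        (trans (cong₂ _+_ (+-identityʳ (L ∸ toℕ v)) (*-zeroʳ c)) (+-identityʳ (L ∸ toℕ v)))
appendInv-punchIn c v w cs (suc d) w-distinct =
  cong₂ (λ a b → a + suc (toℕ d) + c * b) (letters-above-punchIn v w w-distinct) (letters-below-punchIn v w w-distinct true)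

invc-extend : ∀ c (v : Fin (suc L)) (w : Vec (Fin L) L) cs d → distinct w ≡ true →
  invc c (map (punchIn v) w ∷ʳ v , cs ∷ʳ d) ≡ invc c (w , cs) + lastInv c L v d
invc-extend c v w cs d w-distinct = trans (invcʷ-∷ʳ c (map (punchIn v) w) cs v d)
  (cong₂ _+_ (invcʷ-punchIn c v w cs) (appendInv-punchIn c v w cs d w-distinct))

∑-lastInv : ∀ c L (h : ℕ → ℕ) → ∑[ v < suc L ] ∑[ d < c ] h (lastInv c L v d) ≡ ∑[ j < c * suc L ] h (toℕ j)
∑-lastInv zero L h = sum-replicate-zero (suc L)
∑-lastInv (suc c) L h = begin
  ∑[ v < suc L ] (h (L ∸ toℕ v) + ∑[ d < c ] h (L ∸ toℕ v + suc (toℕ d) + suc c * toℕ v))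
    ≡⟨ sum-cong-≗ {suc L} (λ v → cong (_+_ (h (L ∸ toℕ v))) (sum-cong-≗ {c} λ d → cong h (coloured v d))) ⟩
  ∑[ v < suc L ] (h (L ∸ toℕ v) + ∑[ d < c ] h (suc L + (toℕ v * c + toℕ d)))
    ≡⟨ ∑-distrib-+ {suc L} (λ v → h (L ∸ toℕ v)) (λ v → ∑[ d < c ] h (suc L + (toℕ v * c + toℕ d))) ⟩
  ∑[ v < suc L ] h (L ∸ toℕ v) + ∑[ v < suc L ] ∑[ d < c ] h (suc L + (toℕ v * c + toℕ d))
    ≡⟨ cong₂ _+_ (∑-toℕ-reverse L h) (∑-toℕ-* (suc L) c (λ x → h (suc L + x))) ⟩
  ∑[ j < suc L ] h (toℕ j) + ∑[ j < suc L * c ] h (suc L + toℕ j)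
    ≡⟨ ∑-toℕ-+ (suc L) (suc L * c) h ⟨
  ∑[ j < suc L + suc L * c ] h (toℕ j)
    ≡⟨ cong (λ n → ∑[ j < suc L + n ] h (toℕ j)) (*-comm (suc L) c) ⟩
  ∑[ j < suc c * suc L ] h (toℕ j) ∎
  where
  coloured : ∀ (v : Fin (suc L)) (d : Fin c) →
    L ∸ toℕ v + suc (toℕ d) + suc c * toℕ v ≡ suc L + (toℕ v * c + toℕ d)
  coloured v d = trans (regroup (L ∸ toℕ v) (toℕ v) c (toℕ d))
    (cong (λ y → suc y + (toℕ v * c + toℕ d)) (m∸n+n≡m (toℕ≤pred[n] v)))
    where
    regroup : ∀ x v c d → x + suc d + suc c * v ≡ suc (x + v) + (v * c + d)
    regroup = solve-∀

∑-allWords-∷ : ∀ m L (F : Vec (Fin m) (suc L) → ℕ) →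
  ∑[ w ∈ allWords m (suc L) ] F w ≡ ∑[ x < m ] ∑[ w ∈ allWords m L ] F (x ∷ w)
∑-allWords-∷ m L F = begin
  ∑ˡ (concatMap (λ x → List.map (x ∷_) (allWords m L)) (allFin m)) F
    ≡⟨ ∑ˡ-concatMap (λ x → List.map (x ∷_) (allWords m L)) (allFin m) F ⟩
  ∑[ x ∈ allFin m ] ∑ˡ (List.map (x ∷_) (allWords m L)) F
    ≡⟨ ∑ˡ-allFin m _ ⟩
  ∑[ x < m ] ∑ˡ (List.map (x ∷_) (allWords m L)) F
    ≡⟨ sum-cong-≗ {m} (λ x → ∑ˡ-map (x ∷_) (allWords m L) F) ⟩
  ∑[ x < m ] ∑[ w ∈ allWords m L ] F (x ∷ w) ∎

∑-allWords-∷ʳ : ∀ m L (F : Vec (Fin m) (suc L) → ℕ) →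
  ∑[ w ∈ allWords m (suc L) ] F w ≡ ∑[ w ∈ allWords m L ] ∑[ x < m ] F (w ∷ʳ x)
∑-allWords-∷ʳ m zero F = trans (∑-allWords-∷ m zero F)
  (trans (sum-cong-≗ {m} (λ x → +-identityʳ (F (x ∷ [])))) (sym (+-identityʳ _)))
∑-allWords-∷ʳ m (suc L) F = begin
  ∑[ w ∈ allWords m (suc (suc L)) ] F w
    ≡⟨ ∑-allWords-∷ m (suc L) F ⟩
  ∑[ x < m ] ∑[ w ∈ allWords m (suc L) ] F (x ∷ w)
    ≡⟨ sum-cong-≗ {m} (λ x → ∑-allWords-∷ʳ m L (λ w → F (x ∷ w))) ⟩
  ∑[ x < m ] ∑[ w ∈ allWords m L ] ∑[ y < m ] F ((x ∷ w) ∷ʳ y)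
    ≡⟨ ∑-allWords-∷ m L (λ w → ∑[ y < m ] F (w ∷ʳ y)) ⟨
  ∑[ w ∈ allWords m (suc L) ] ∑[ y < m ] F (w ∷ʳ y) ∎

∑-notIn : ∀ m L (v : Fin (suc m)) (H : Vec (Fin (suc m)) L → ℕ) →
  ∑[ w ∈ allWords (suc m) L ] (if notIn v w then H w else 0) ≡ ∑[ w ∈ allWords m L ] H (map (punchIn v) w)
∑-notIn m zero v H = refl
∑-notIn m (suc L) v H = begin
  ∑[ w ∈ allWords (suc m) (suc L) ] (if notIn v w then H w else 0)
    ≡⟨ ∑-allWords-∷ (suc m) L (λ w → if notIn v w then H w else 0) ⟩
  ∑[ x < suc m ] ∑[ w ∈ allWords (suc m) L ] (if v≢ x ∧ notIn v w then H (x ∷ w) else 0)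
    ≡⟨ sum-cong-≗ {suc m} (λ x → trans (∑ˡ-cong (allWords (suc m) L) λ w → if-∧ (v≢ x) (notIn v w) (H (x ∷ w)))
                                       (∑ˡ-if (v≢ x) (allWords (suc m) L) _)) ⟩
  ∑[ x < suc m ] (if v≢ x then ∑[ w ∈ allWords (suc m) L ] (if notIn v w then H (x ∷ w) else 0) else 0)
    ≡⟨ sum-cong-≗ {suc m} (λ x → cong (if v≢ x then_else 0) (∑-notIn m L v (λ w → H (x ∷ w)))) ⟩
  ∑[ x < suc m ] (if v≢ x then Hₓ x else 0)
    ≡⟨ sum-remove {m} {v} (λ x → if v≢ x then Hₓ x else 0) ⟩
  (if v≢ v then Hₓ v else 0) + ∑[ y < m ] (if v≢ (punchIn v y) then Hₓ (punchIn v y) else 0)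
    ≡⟨ cong₂ _+_ (cong (λ b → if not b then Hₓ v else 0) (dec-true (v ≟ v) refl))
                 (sum-cong-≗ {m} λ y → cong (λ b → if not b then Hₓ (punchIn v y) else 0)
                                            (dec-false (v ≟ punchIn v y) (punchInᵢ≢i v y ∘ sym))) ⟩
  ∑[ y < m ] Hₓ (punchIn v y)
    ≡⟨ ∑-allWords-∷ m L (λ w → H (map (punchIn v) w)) ⟨
  ∑[ w ∈ allWords m (suc L) ] H (map (punchIn v) w) ∎
  where
  v≢ : Fin (suc m) → Bool
  v≢ x = not (does (v ≟ x))
  Hₓ : Fin (suc m) → ℕ
  Hₓ x = ∑[ w ∈ allWords m L ] H (x ∷ map (punchIn v) w)

∑-perms : ∀ n (F : Vec (Fin n) n → ℕ) → ∑[ w ∈ perms n ] F w ≡ ∑[ w ∈ allWords n n ] (if distinct w then F w else 0)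
∑-perms n F = trans (∑ˡ-filterᵇ isPerm (allWords n n) F)
  (∑ˡ-cong (allWords n n) λ w → cong (if_then F w else 0) (isPerm≡distinct w))

∑-perms-suc : ∀ L (F : Vec (Fin (suc L)) (suc L) → ℕ) →
  ∑[ w ∈ perms (suc L) ] F w ≡ ∑[ v < suc L ] ∑[ w ∈ perms L ] F (map (punchIn v) w ∷ʳ v)
∑-perms-suc L F = begin
  ∑[ w ∈ perms (suc L) ] F w
    ≡⟨ ∑-perms (suc L) F ⟩
  ∑[ w ∈ allWords (suc L) (suc L) ] (if distinct w then F w else 0)
    ≡⟨ ∑-allWords-∷ʳ (suc L) L (λ w → if distinct w then F w else 0) ⟩
  ∑[ w ∈ allWords (suc L) L ] ∑[ v < suc L ] (if distinct (w ∷ʳ v) then F (w ∷ʳ v) else 0)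
    ≡⟨ ∑ˡ-∑-comm (allWords (suc L) L) (λ w v → if distinct (w ∷ʳ v) then F (w ∷ʳ v) else 0) ⟩
  ∑[ v < suc L ] ∑[ w ∈ allWords (suc L) L ] (if distinct (w ∷ʳ v) then F (w ∷ʳ v) else 0)
    ≡⟨ sum-cong-≗ {suc L} (λ v → ∑ˡ-cong (allWords (suc L) L) λ w →
         trans (cong (if_then F (w ∷ʳ v) else 0) (distinct-∷ʳ w v)) (if-∧ (notIn v w) (distinct w) (F (w ∷ʳ v)))) ⟩
  ∑[ v < suc L ] ∑[ w ∈ allWords (suc L) L ] (if notIn v w then (if distinct w then F (w ∷ʳ v) else 0) else 0)
    ≡⟨ sum-cong-≗ {suc L} (λ v → ∑-notIn L L v (λ w → if distinct w then F (w ∷ʳ v) else 0)) ⟩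
  ∑[ v < suc L ] ∑[ w ∈ allWords L L ] (if distinct (map (punchIn v) w) then F (map (punchIn v) w ∷ʳ v) else 0)
    ≡⟨ sum-cong-≗ {suc L} (λ v → ∑ˡ-cong (allWords L L) λ w →
         cong (if_then F (map (punchIn v) w ∷ʳ v) else 0) (distinct-punchIn v w)) ⟩
  ∑[ v < suc L ] ∑[ w ∈ allWords L L ] (if distinct w then F (map (punchIn v) w ∷ʳ v) else 0)
    ≡⟨ sum-cong-≗ {suc L} (λ v → ∑-perms L (λ w → F (map (punchIn v) w ∷ʳ v))) ⟨
  ∑[ v < suc L ] ∑[ w ∈ perms L ] F (map (punchIn v) w ∷ʳ v) ∎

∑-G : ∀ c n (F : Vec (Fin n) n × Vec (Fin c) n → ℕ) →
  ∑[ σ ∈ G c n ] F σ ≡ ∑[ w ∈ perms n ] ∑[ cs ∈ allWords c n ] F (w , cs)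
∑-G c n F = trans (∑ˡ-concatMap _ (perms n) F) (∑ˡ-cong (perms n) λ w → ∑ˡ-map (w ,_) (allWords c n) F)

∑-G-suc : ∀ c L (F : Vec (Fin (suc L)) (suc L) → Vec (Fin c) (suc L) → ℕ) →
  ∑[ w ∈ perms (suc L) ] ∑[ cs ∈ allWords c (suc L) ] F w cs ≡
  ∑[ v < suc L ] ∑[ d < c ] ∑[ w ∈ perms L ] ∑[ cs ∈ allWords c L ] F (map (punchIn v) w ∷ʳ v) (cs ∷ʳ d)
∑-G-suc c L F = begin
  ∑[ w ∈ perms (suc L) ] ∑[ cs ∈ allWords c (suc L) ] F w cs
    ≡⟨ ∑-perms-suc L (λ w → ∑[ cs ∈ allWords c (suc L) ] F w cs) ⟩
  ∑[ v < suc L ] ∑[ w ∈ perms L ] ∑[ cs ∈ allWords c (suc L) ] F (extend v w) cs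
    ≡⟨ sum-cong-≗ {suc L} (λ v → ∑ˡ-cong (perms L) λ w → ∑-allWords-∷ʳ c L (F (extend v w))) ⟩
  ∑[ v < suc L ] ∑[ w ∈ perms L ] ∑[ cs ∈ allWords c L ] ∑[ d < c ] F (extend v w) (cs ∷ʳ d)
    ≡⟨ sum-cong-≗ {suc L} (λ v → ∑ˡ-cong (perms L) λ w →
         ∑ˡ-∑-comm (allWords c L) (λ cs d → F (extend v w) (cs ∷ʳ d))) ⟩
  ∑[ v < suc L ] ∑[ w ∈ perms L ] ∑[ d < c ] ∑[ cs ∈ allWords c L ] F (extend v w) (cs ∷ʳ d)
    ≡⟨ sum-cong-≗ {suc L} (λ v → ∑ˡ-∑-comm (perms L) (λ w d → ∑[ cs ∈ allWords c L ] F (extend v w) (cs ∷ʳ d))) ⟩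
  ∑[ v < suc L ] ∑[ d < c ] ∑[ w ∈ perms L ] ∑[ cs ∈ allWords c L ] F (extend v w) (cs ∷ʳ d) ∎
  where
  extend : Fin (suc L) → Vec (Fin L) L → Vec (Fin (suc L)) (suc L)
  extend v w = map (punchIn v) w ∷ʳ v

-- The distribution of inv_c

sumG : (c n : ℕ) → (ℕ → ℕ) → ℕ
sumG c n g = ∑[ w ∈ perms n ] ∑[ cs ∈ allWords c n ] g (invc c (w , cs))

sumG-cong : ∀ c n {g g′ : ℕ → ℕ} → (∀ t → g t ≡ g′ t) → sumG c n g ≡ sumG c n g′
sumG-cong c n g≗g′ = ∑ˡ-cong (perms n) λ w → ∑ˡ-cong (allWords c n) λ cs → g≗g′ (invc c (w , cs))

sumG-suc : ∀ c L (g : ℕ → ℕ) → sumG c (suc L) g ≡ ∑[ j < c * suc L ] sumG c L (λ t → g (t + toℕ j))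
sumG-suc c L g = begin
  sumG c (suc L) g
    ≡⟨ ∑-G-suc c L (λ w cs → g (invc c (w , cs))) ⟩
  ∑[ v < suc L ] ∑[ d < c ] ∑[ w ∈ perms L ] ∑[ cs ∈ allWords c L ] g (invc c (map (punchIn v) w ∷ʳ v , cs ∷ʳ d))
    ≡⟨ sum-cong-≗ {suc L} (λ v → sum-cong-≗ {c} λ d → ∑ˡ-filterᵇ-cong isPerm (allWords L L) λ w w-perm →
         ∑ˡ-cong (allWords c L) λ cs → cong g (invc-extend c v w cs d (trans (sym (isPerm≡distinct w)) w-perm))) ⟩
  ∑[ v < suc L ] ∑[ d < c ] sumG c L (λ t → g (t + lastInv c L v d))
    ≡⟨ ∑-lastInv c L (λ s → sumG c L (λ t → g (t + s))) ⟩
  ∑[ j < c * suc L ] sumG c L (λ t → g (t + toℕ j)) ∎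

δ : ℤ → ℕ → ℕ
δ k t = 𝟙 (does (+ t ℤ.≟ k))

δ-shift : ∀ k t j → δ k (t + j) ≡ δ (k - + j) t
δ-shift k t j = cong 𝟙 (does-⇔ (mk⇔ to from) (+ (t + j) ℤ.≟ k) (+ t ℤ.≟ k - + j))
  where
  to : + t +ℤ + j ≡ k → + t ≡ k - + j
  to t+j≡k = trans (sym (//-rightDividesʳ (+ j) (+ t))) (cong (λ i → i - + j) t+j≡k)
  from : + t ≡ k - + j → + t +ℤ + j ≡ k
  from t≡k-j = trans (cong (λ i → i +ℤ + j) t≡k-j) (//-rightDividesˡ (+ j) k)

icount≡sumG : ∀ c n k → icount c n k ≡ sumG c n (δ k)
icount≡sumG c n (+ k) = trans (length-filterᵇ (λ σ → invc c σ ≡ᵇ k) (G c n)) (∑-G c n (λ σ → 𝟙 (invc c σ ≡ᵇ k)))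
icount≡sumG c n -[1+ k ] = sym (trans (∑ˡ-cong (perms n) λ w → ∑ˡ-zero (allWords c n)) (∑ˡ-zero (perms n)))

icount-suc : ∀ c L k → icount c (suc L) k ≡ ∑[ j < c * suc L ] icount c L (k - + toℕ j)
icount-suc c L k = begin
  icount c (suc L) k                                  ≡⟨ icount≡sumG c (suc L) k ⟩
  sumG c (suc L) (δ k)                                ≡⟨ sumG-suc c L (δ k) ⟩
  ∑[ j < c * suc L ] sumG c L (λ t → δ k (t + toℕ j)) ≡⟨ sum-cong-≗ {c * suc L} (λ j →
                                                           sumG-cong c L λ t → δ-shift k t (toℕ j)) ⟩
  ∑[ j < c * suc L ] sumG c L (δ (k - + toℕ j))       ≡⟨ sum-cong-≗ {c * suc L} (λ j →
                                                           icount≡sumG c L (k - + toℕ j)) ⟨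
  ∑[ j < c * suc L ] icount c L (k - + toℕ j)         ∎

theorem3p3 : (n c k : ℕ) → 1 < n → 1 ≤ c → k ≤ (c ∸ 1) * n + c * (n C 2) →
    + icount c n (+ k) ≡
      (+ icount c n (+ k - + 1) +ℤ + icount c (n ∸ 1) (+ k)) - + icount c (n ∸ 1) (+ k - + (c * n))
theorem3p3 (suc L) c k _ _ _ =
  window-recurrence (icount c (suc L)) (icount c L) (c * suc L) (icount-suc c L) (+ k)
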